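{- No non-collapsing, all-voting, entirely execution bounded chemical reaction decider stably decides the majority predicate $\phi(x_1,x_2)=1\iff x_1\ge x_2$ (input species $X_1,X_2$), and none stably decides the parity predicate $\phi(x)=1\iff x\equiv1\bmod 2$ (single input species $X$).
   Context: A chemical reaction network (CRN) is a pair $(\Lambda,R)$ of a finite species set $\Lambda$ and a finite set of reactions $(\vec r,\vec p)\in\mathbb{N}^\Lambda\times\mathbb{N}^\Lambda$. Configurations are $\vec c\in\mathbb{N}^\Lambda$ of size $\|\vec c\|=\sum_S\vec c(S)$; a reaction is applicable if $\vec r\le\vec c$ componentwise and yields $\vec c-\vec r+\vec p$. An execution is a sequence of configurations each obtained from the previous by one applicable reaction, consecutive ones distinct; $\vec c\Rightarrow\vec d$ means a finite execution leads from $\vec c$ to $\vec d$. A chemical reaction decider (CRD) $(\Lambda,R,\Sigma,\Upsilon_1,\Upsilon_0,\vec s)$ has input species $\Sigma\subseteq\Lambda$, disjoint yes/no voter sets $\Upsilon_1,\Upsilon_0\subseteq\Lambda$ and initial context $\vec s\in\mathbb{N}^{\Lambda\setminus\Sigma}$; valid initial configurations are $\vec s+\vec x$ with $\vec x$ zero outside $\Sigma$. It is all-voting if $\Upsilon_1\cup\Upsilon_0=\Lambda$. Output $\Phi(\vec c)=1$ if some yes-voter and no no-voter is present, $0$ if some no-voter and no yes-voter is present, undefined otherwise; $\vec c$ is stable if $\Phi$ is unchanged on all configurations reachable from $\vec c$. The CRD stably decides a predicate $\psi:\mathbb{N}^\Sigma\to\{0,1\}$ if from every configuration reachable from a valid initial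 configuration $\vec i$ one can reach a stable $\vec c'$ with $\Phi(\vec c')=\psi(\vec i\restriction\Sigma)$. It is entirely execution bounded if every execution starting from any configuration whatsoever is finite. Its output size is $s(n)=\min\{\|\vec y\|\mid \vec x\Rightarrow\vec y,\ \|\vec x\|=n,\ \vec x\text{ a valid initial configuration},\ \vec y\text{ stable}\}$, and it is non-collapsing if $\lim_{n\to\infty}s(n)=\infty$. -}

module Defs where

open import Data.Nat using (ℕ; zero; suc; _+_; _∸_; _≤_; _<_; _≥_; _%_; _≤ᵇ_; _≡ᵇ_)
open import Data.Fin using (Fin; zero; suc)
open import Data.Bool using (Bool; true; false)
open import Data.List using (List)
open import Data.List.Membership.Propositional using (_∈_)
open import Data.Product using (Σ; ∃; _×_; _,_)
open import Data.Sum using (_⊎_)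
open import Relation.Binary.PropositionalEquality using (_≡_; _≢_)
open import Relation.Binary.Construct.Closure.ReflexiveTransitive using (Star)
open import Relation.Nullary using (¬_)
open import Function.Definitions using (Injective)

Config : ℕ → Set
Config k = Fin k → ℕ

size : ∀ {k} → Config k → ℕ
size {zero}  c = 0
size {suc k} c = c zero + size {k} (λ i → c (suc i))

Reaction : ℕ → Set
Reaction k = Config k × Config k   -- (reactants r, products p)

record CRN (k : ℕ) : Set where
  field
    reactions : List (Reaction k)

Step : ∀ {k} → CRN k → Config k → Config k → Set
Step {k} C c d =
  Σ (Reaction k) λ rp → let r = Data.Product.proj₁ rp ; p = Data.Product.proj₂ rp in
    (rp ∈ CRN.reactions C)
    × (∀ i → r i ≤ c i)
    × (∀ i → d i ≡ (c i ∸ r i) + p i)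
    × ¬ (∀ i → c i ≡ d i)

Reach : ∀ {k} → CRN k → Config k → Config k → Set
Reach C = Star (Step C)

record CRD (k σ : ℕ) : Set where
  field
    crn     : CRN k
    input   : Fin σ → Fin k
    input-inj : Injective _≡_ _≡_ input
    yes     : Fin k → Bool
    no      : Fin k → Bool
    disjoint : ∀ i → yes i ≡ true → no i ≡ false
    context : Config k
    context-Σ : ∀ j → context (input j) ≡ 0

module _ {k σ : ℕ} (D : CRD k σ) where
  open CRD D

  -- valid initial configuration: s + x with x zero outside Σ
  ValidInit : Config k → Set
  ValidInit c = ∀ i → (∀ j → input j ≢ i) → c i ≡ context i

  restrict : Config k → (Fin σ → ℕ)
  restrict c j = c (input j)

  -- Φ(c) = b  (Φ is partial)
  Output : Config k → Bool → Set
  Output c true  = (∃ λ i → yes i ≡ true × 0 < c i) × (∀ i → no i ≡ true → c i ≡ 0)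
  Output c false = (∃ λ i → no i ≡ true × 0 < c i) × (∀ i → yes i ≡ true → c i ≡ 0)

  Stable : Config k → Set
  Stable c = ∀ d → Reach crn c d → ∀ b → (Output c b → Output d b) × (Output d b → Output c b)

  StablyDecides : ((Fin σ → ℕ) → Bool) → Set
  StablyDecides ψ = ∀ i → ValidInit i → ∀ c → Reach crn i c →
    ∃ λ c' → Reach crn c c' × Stable c' × Output c' (ψ (restrict i))

  AllVoting : Set
  AllVoting = ∀ i → yes i ≡ true ⊎ no i ≡ true

  EntirelyExecutionBounded : Set
  EntirelyExecutionBounded = ¬ (Σ (ℕ → Config k) λ f → ∀ n → Step crn (f n) (f (suc n)))

  -- lim_{n→∞} s(n) = ∞ where s(n) = min{‖y‖ | x ⇒ y, ‖x‖ = n, x valid initial, y stable}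
  -- (min of the empty set read as ∞)
  NonCollapsing : Set
  NonCollapsing = ∀ M → ∃ λ N → ∀ n → n ≥ N →
    ∀ x → ValidInit x → size x ≡ n → ∀ y → Reach crn x y → Stable y → size y ≥ M

-- majority: φ(x₁,x₂) = 1 ⇔ x₁ ≥ x₂   (X₁ = input 0, X₂ = input 1)
majority : (Fin 2 → ℕ) → Bool
majority x = x (suc zero) ≤ᵇ x zero

parity : (Fin 1 → ℕ) → Bool
parity x = (x zero % 2) ≡ᵇ 1

{-# OPTIONS --safe #-}
module Submission where

-- An entirely execution bounded CRN has a linear potential: weights w with w · p + ‖r‖ ≤ w · r
-- for every reaction r → p that can fire. This is a Farkas-type alternative, proved by
-- Fourier–Motzkin elimination over ℕ: if the inequalities have no solution, some nonempty
-- multiset of reactions produces at least what it consumes, and firing it over and over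
-- is an infinite execution.
-- Now add input molecules one at a time so that the predicate flips at every step. A stable
-- configuration y with the old answer, plus the new molecule, must reach a stable y′ with the
-- new answer. As every species votes, y and y′ have disjoint supports, so every molecule of y
-- is consumed on the way and w · y′ + ‖y‖ ≤ w · y + max w. Non-collapsing makes ‖y‖ > Σ w for
-- late inputs, so w · y decreases forever, which is impossible.

open import Defs
open import Data.Bool using (Bool; true; false)
open import Data.Empty using (⊥; ⊥-elim)
open import Data.Fin using (Fin; zero; suc) renaming (_≟_ to _≟ᶠ_)
open import Data.Fin.Properties using (all?)
open import Data.List using (List; []; _∷_; _++_; map; filter; cartesianProductWith)
open import Data.List.Membership.Propositional using (_∈_)
open import Data.List.Membership.Propositional.Properties
  using (∈-filter⁺; ∈-filter⁻; ∈-map⁺; ∈-++⁺ˡ; ∈-++⁺ʳ; ∈-cartesianProductWith⁺)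
open import Data.List.NonEmpty using (List⁺; _∷_; toList)
open import Data.List.Relation.Unary.All as All using (All; []; _∷_)
import Data.List.Relation.Unary.All.Properties as Allₚ
open import Data.Nat
  using (ℕ; zero; suc; _+_; _*_; _∸_; _≤_; _<_; _≤?_; _≟_; _⊔_; z≤n; NonZero; >-nonZero;
         _/_; _%_; _≤ᵇ_; _≡ᵇ_; ⌊_/2⌋; ⌈_/2⌉)
open import Data.Nat.DivMod using (m≡m%n+[m/n]*n; m%n<n; m/n*n≤m)
open import Data.Nat.Induction using (<-wellFounded)
open import Data.Nat.Properties
open import Data.Nat.Tactic.RingSolver using (solve-∀)
open import Data.Product using (Σ; Σ-syntax; ∃; _×_; _,_; proj₁; proj₂)
open import Data.Sum using (_⊎_; inj₁; inj₂; [_,_]′)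
open import Data.Vec.Functional using (tail) renaming (_∷_ to _◂_)
open import Function using (_∘_; _on_)
open import Function.Definitions using (Injective)
open import Induction.InfiniteDescent using (Descent; descent∧wf⇒empty)
open import Relation.Binary.Construct.Closure.ReflexiveTransitive using (ε; _◅_; _◅◅_; gmap)
open import Relation.Binary.Construct.Closure.Transitive using (TransClosure; [_]; _∷_)
import Relation.Binary.Construct.On as On
open import Relation.Binary.PropositionalEquality
open import Relation.Nullary using (¬_; Dec; yes; no; ¬?)

open import Algebra.Properties.CommutativeSemigroup +-commutativeSemigroup
  using () renaming ( interchange to +-interchange; xy∙z≈xz∙y to +-right-comm
                    ; xy∙z≈x∙zy to [x+y]+z≡x+[z+y]; x∙yz≈xz∙y to x+[y+z]≡[x+z]+y )
open import Algebra.Properties.CommutativeSemigroup *-commutativeSemigroup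
  using () renaming (x∙yz≈y∙xz to *-left-comm)

open ≤-Reasoning

private
  variable
    k n σ : ℕ

-- Vectors over ℕ

infixl 7 _⊛_
infixl 6 _⊕_
infix  8 _·_
infix  4 _≤ᶜ_

0ᶜ : Config n
0ᶜ _ = 0

_⊕_ : Config n → Config n → Config n
(a ⊕ b) i = a i + b i

_⊛_ : ℕ → Config n → Config n
(m ⊛ a) i = m * a i

_≤ᶜ_ : Config n → Config n → Set
a ≤ᶜ b = ∀ i → a i ≤ b i

_·_ : Config n → Config n → ℕ
w · a = size (λ i → w i * a i)

unit : Fin n → Config n
unit zero    zero    = 1
unit zero    (suc _) = 0
unit (suc _) zero    = 0
unit (suc j) (suc i) = unit j i

unit-≡ : (j : Fin n) → unit j j ≡ 1
unit-≡ zero    = refl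
unit-≡ (suc j) = unit-≡ j

unit-≢ : {j i : Fin n} → j ≢ i → unit j i ≡ 0
unit-≢ {j = zero}  {zero}  j≢i = ⊥-elim (j≢i refl)
unit-≢ {j = zero}  {suc _} _   = refl
unit-≢ {j = suc _} {zero}  _   = refl
unit-≢ {j = suc j} {suc i} j≢i = unit-≢ (j≢i ∘ cong suc)

unit≤1 : (j i : Fin n) → unit j i ≤ 1
unit≤1 zero    zero    = ≤-refl
unit≤1 zero    (suc _) = z≤n
unit≤1 (suc _) zero    = z≤n
unit≤1 (suc j) (suc i) = unit≤1 j i

unit-injective : {f : Fin σ → Fin n} → Injective _≡_ _≡_ f →
                 (j i : Fin σ) → unit (f j) (f i) ≡ unit j i
unit-injective {f = f} f-inj j i with j ≟ᶠ i
... | yes refl = trans (unit-≡ (f j)) (sym (unit-≡ j))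
... | no  j≢i  = trans (unit-≢ (j≢i ∘ f-inj)) (sym (unit-≢ j≢i))

size-cong : {a b : Config n} → a ≗ b → size a ≡ size b
size-cong {zero}  _   = refl
size-cong {suc n} a≗b = cong₂ _+_ (a≗b zero) (size-cong (a≗b ∘ suc))

size-0ᶜ : size (0ᶜ {n}) ≡ 0
size-0ᶜ {zero}  = refl
size-0ᶜ {suc n} = size-0ᶜ {n}

size-⊕ : (a b : Config n) → size (a ⊕ b) ≡ size a + size b
size-⊕ {zero}  a b = refl
size-⊕ {suc n} a b =
  trans (cong (a zero + b zero +_) (size-⊕ (tail a) (tail b)))
        (+-interchange (a zero) (b zero) (size (tail a)) (size (tail b)))

size-⊛ : ∀ m (a : Config n) → size (m ⊛ a) ≡ m * size a
size-⊛ {zero}  m a = sym (*-zeroʳ m)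
size-⊛ {suc n} m a =
  trans (cong (m * a zero +_) (size-⊛ m (tail a))) (sym (*-distribˡ-+ m (a zero) _))

size-mono : {a b : Config n} → a ≤ᶜ b → size a ≤ size b
size-mono {zero}  _   = z≤n
size-mono {suc n} a≤b = +-mono-≤ (a≤b zero) (size-mono (a≤b ∘ suc))

component≤size : (a : Config n) (i : Fin n) → a i ≤ size a
component≤size a zero    = m≤m+n (a zero) _
component≤size a (suc i) = ≤-trans (component≤size (tail a) i) (m≤n+m _ (a zero))

1≤size-unit : (j : Fin n) → 1 ≤ size (unit j)
1≤size-unit j = subst (_≤ size (unit j)) (unit-≡ j) (component≤size (unit j) j)

·-cong : (w : Config n) {a b : Config n} → a ≗ b → w · a ≡ w · b
·-cong w a≗b = size-cong (λ i → cong (w i *_) (a≗b i))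

·-⊕ : (w a b : Config n) → w · (a ⊕ b) ≡ w · a + w · b
·-⊕ w a b = trans (size-cong (λ i → *-distribˡ-+ (w i) (a i) (b i)))
                  (size-⊕ (λ i → w i * a i) (λ i → w i * b i))

·-linear : (w : Config n) (β : ℕ) (a : Config n) (α : ℕ) (b : Config n) →
           w · (β ⊛ a ⊕ α ⊛ b) ≡ β * (w · a) + α * (w · b)
·-linear w β a α b = trans (·-⊕ w _ _) (cong₂ _+_ (·-⊛ β a) (·-⊛ α b))
  where
  ·-⊛ : ∀ m a → w · (m ⊛ a) ≡ m * (w · a)
  ·-⊛ m a = trans (size-cong (λ i → *-left-comm (w i) m (a i))) (size-⊛ m (λ i → w i * a i))

·-unit≤size : (w : Config n) (j : Fin n) → w · unit j ≤ size w
·-unit≤size w j = size-mono {a = λ i → w i * unit j i} λ i →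
  ≤-trans (*-monoʳ-≤ (w i) (unit≤1 j i)) (≤-reflexive (*-identityʳ (w i)))

-- Infinite executions

module _ {A : Set} {_⟶_ : A → A → Set} {P : A → Set}
         (next : ∀ {x} → P x → ∃ λ y → TransClosure _⟶_ x y × P y) where

  private
    Pending : Set
    Pending = Σ A λ x → ∃ λ y → TransClosure _⟶_ x y × P y

    advance : Pending → Pending
    advance (_ , y , [ _ ]               , Py) = y , next Py
    advance (_ , y , _∷_ {y = z} _ steps , Py) = z , y , steps , Py

    advance-step : (s : Pending) → proj₁ s ⟶ proj₁ (advance s)
    advance-step (_ , _ , [ step ]  , _) = step
    advance-step (_ , _ , step ∷ _  , _) = step

  infinite-chain : ∀ {x} → P x → Σ (ℕ → A) λ f → ∀ t → f t ⟶ f (suc t)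
  infinite-chain {x} Px = proj₁ ∘ run , λ t → advance-step (run t)
    where
    run : ℕ → Pending
    run zero    = x , next Px
    run (suc t) = advance (run t)

-- A Farkas alternative by Fourier–Motzkin elimination

record Constraint (n : ℕ) : Set where
  field
    lhs rhs : Config n
    slack   : ℕ
open Constraint

infix 4 _⊨_

_⊨_ : Config n → Constraint n → Set
w ⊨ e = w · lhs e + slack e ≤ w · rhs e

-- The dual side of the alternative: pairs (a , a′), read as a − a′, closed under positive
-- combinations and under decreasing a − a′.
record Cone (n : ℕ) : Set₁ where
  field
    Member  : Config n → Config n → Set
    weaken  : ∀ {a a' b b'} → Member a a' → (∀ i → b i + a' i ≤ a i + b' i) → Member b b'
    combine : ∀ {a a' b b'} α β → 0 < β → Member a a' → Member b b' →
              Member (β ⊛ a ⊕ α ⊛ b) (β ⊛ a' ⊕ α ⊛ b')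
open Cone

Admissible : Cone n → Constraint n → Set
Admissible K e = Member K (lhs e) (rhs e)

tailCone : Cone (suc n) → Cone n
tailCone K = record
  { Member  = λ a a' → Member K (0 ◂ a) (0 ◂ a')
  ; weaken  = λ m le → weaken K m λ { zero → z≤n ; (suc i) → le i }
  ; combine = λ α β 0<β m m' → weaken K (combine K α β 0<β m m')
                λ { zero → ≤-reflexive (+-comm 0 _) ; (suc i) → ≤-refl }
  }

tail-member : (K : Cone (suc n)) {a a' : Config (suc n)} →
              Member K a a' → a' zero ≤ a zero → Member (tailCone K) (tail a) (tail a')
tail-member K m a'₀≤a₀ = weaken K m λ { zero → m≤n⇒m≤n+o 0 a'₀≤a₀ ; (suc i) → ≤-refl }

cross-balance : ∀ {x x' y y'} → x' ≤ x → y ≤ y' →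
                (y' ∸ y) * x' + (x ∸ x') * y' ≡ (y' ∸ y) * x + (x ∸ x') * y
cross-balance {x} {x'} {y} {y'} x'≤x y≤y' = begin-equality
  β * x' + α * y'       ≡⟨ cong (λ v → β * x' + α * v) (sym (m+[n∸m]≡n y≤y')) ⟩
  β * x' + α * (y + β)  ≡⟨ regroup x' y α β ⟩
  β * (x' + α) + α * y  ≡⟨ cong (λ v → β * v + α * y) (m+[n∸m]≡n x'≤x) ⟩
  β * x + α * y         ∎
  where
  α = x ∸ x'
  β = y' ∸ y
  regroup : ∀ x' y α β → β * x' + α * (y + β) ≡ β * (x' + α) + α * y
  regroup = solve-∀

upper-shift : ∀ X r α L b R → X * α + L + b ≤ R → X * (r + α) + L + b ≤ X * r + R
upper-shift X r α L b R bound = begin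
  X * (r + α) + L + b      ≡⟨ regroup X r α L b ⟩
  X * r + (X * α + L + b)  ≤⟨ +-monoʳ-≤ (X * r) bound ⟩
  X * r + R                ∎
  where
  regroup : ∀ X r α L b → X * (r + α) + L + b ≡ X * r + (X * α + L + b)
  regroup = solve-∀

lower-shift : ∀ X l β L b R → L + b ≤ R + X * β → X * l + L + b ≤ X * (l + β) + R
lower-shift X l β L b R bound = begin
  X * l + L + b        ≡⟨ +-assoc (X * l) L b ⟩
  X * l + (L + b)      ≤⟨ +-monoʳ-≤ (X * l) bound ⟩
  X * l + (R + X * β)  ≡⟨ regroup X l β R ⟩
  X * (l + β) + R      ∎
  where
  regroup : ∀ X l β R → X * l + (R + X * β) ≡ X * (l + β) + R
  regroup = solve-∀

eliminant-bound : ∀ α β X Lu bu Ru Ll bl Rl .{{_ : NonZero β}} →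
                  β * Lu + α * Ll + (β * bu + α * bl + α * β) ≤ β * Ru + α * Rl →
                  X * β + Rl ≤ Ll + bl + β → X * α + Lu + bu ≤ Ru
eliminant-bound α β X Lu bu Ru Ll bl Rl eliminated tight =
  *-cancelˡ-≤ β (+-cancelʳ-≤ (α * Rl) _ _ (begin
    β * (X * α + Lu + bu) + α * Rl               ≡⟨ regroup₁ α β X Lu bu Rl ⟩
    β * Lu + β * bu + α * (X * β + Rl)           ≤⟨ +-monoʳ-≤ (β * Lu + β * bu) (*-monoʳ-≤ α tight) ⟩
    β * Lu + β * bu + α * (Ll + bl + β)          ≡⟨ regroup₂ α β Lu bu Ll bl ⟩
    β * Lu + α * Ll + (β * bu + α * bl + α * β)  ≤⟨ eliminated ⟩
    β * Ru + α * Rl                              ∎))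
  where
  regroup₁ : ∀ α β X Lu bu Rl →
             β * (X * α + Lu + bu) + α * Rl ≡ β * Lu + β * bu + α * (X * β + Rl)
  regroup₁ = solve-∀
  regroup₂ : ∀ α β Lu bu Ll bl →
             β * Lu + β * bu + α * (Ll + bl + β) ≡ β * Lu + α * Ll + (β * bu + α * bl + α * β)
  regroup₂ = solve-∀

round-up : ∀ A β .{{_ : NonZero β}} → ∃ λ X → A ≤ X * β × X * β ≤ A + β
round-up A β = suc (A / β) , A≤ , ≤A+β
  where
  A≤ : A ≤ suc (A / β) * β
  A≤ = begin
    A                  ≡⟨ m≡m%n+[m/n]*n A β ⟩
    A % β + A / β * β  ≤⟨ +-monoˡ-≤ (A / β * β) (<⇒≤ (m%n<n A β)) ⟩
    β + A / β * β      ∎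
  ≤A+β : suc (A / β) * β ≤ A + β
  ≤A+β = begin
    β + A / β * β  ≤⟨ +-monoʳ-≤ β (m/n*n≤m A β) ⟩
    β + A          ≡⟨ +-comm β A ⟩
    A + β          ∎

common-witness : {A : Set} {L : A → ℕ → Set} {U : ℕ → Set} →
                 (∀ {a x y} → x ≤ y → L a x → L a y) → U 0 →
                 {as : List A} → All (λ a → ∃ λ x → L a x × U x) as →
                 ∃ λ X → All (λ a → L a X) as × U X
common-witness mono U0 [] = 0 , [] , U0
common-witness {U = U} mono U0 ((x , Lx , Ux) ∷ witnesses) =
  let X , LX , UX = common-witness mono U0 witnesses
  in  x ⊔ X
    , mono (m≤m⊔n x X) Lx ∷ All.map (mono (m≤n⊔m x X)) LX
    , [ (λ x⊔X≡x → subst U (sym x⊔X≡x) Ux) , (λ x⊔X≡X → subst U (sym x⊔X≡X) UX) ]′ (⊔-sel x X)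

module Elimination {n : ℕ} where

  -- The constraint reads w · (rhs e − lhs e) ≥ slack e, with w₀-coefficient β e − α e (one of
  -- the two truncated differences is 0). Upper constraints bound w₀ from above, the others
  -- from below.
  Upper : Constraint (suc n) → Set
  Upper e = rhs e zero ≤ lhs e zero

  upper? : (e : Constraint (suc n)) → Dec (Upper e)
  upper? e = rhs e zero ≤? lhs e zero

  lower? : (e : Constraint (suc n)) → Dec (¬ Upper e)
  lower? e = ¬? (upper? e)

  uppers lowers : List (Constraint (suc n)) → List (Constraint (suc n))
  uppers = filter upper?
  lowers = filter lower?

  α β : Constraint (suc n) → ℕ
  α e = lhs e zero ∸ rhs e zero
  β e = rhs e zero ∸ lhs e zero

  β-positive : ∀ {l} → ¬ Upper l → 0 < β l
  β-positive ¬up = m<n⇒0<n∸m (≰⇒> ¬up)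

  dropHead : Constraint (suc n) → Constraint n
  dropHead e = record { lhs = tail (lhs e) ; rhs = tail (rhs e) ; slack = slack e }

  -- β l · u + α u · l cancels w₀; the extra slack α u * β l pays for rounding w₀ up to an
  -- integer (see round-up).
  eliminant : Constraint (suc n) → Constraint (suc n) → Constraint n
  eliminant u l = record
    { lhs   = tail (β l ⊛ lhs u ⊕ α u ⊛ lhs l)
    ; rhs   = tail (β l ⊛ rhs u ⊕ α u ⊛ rhs l)
    ; slack = β l * slack u + α u * slack l + α u * β l
    }

  eliminate : List (Constraint (suc n)) → List (Constraint n)
  eliminate es = map dropHead (uppers es) ++ cartesianProductWith eliminant (uppers es) (lowers es)

  eliminate-admissible : (K : Cone (suc n)) {es : List (Constraint (suc n))} →
                         All (Admissible K) es → All (Admissible (tailCone K)) (eliminate es)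
  eliminate-admissible K {es} adm =
    Allₚ.++⁺ (Allₚ.map⁺ (All.tabulate dropHead-admissible))
             (Allₚ.cartesianProductWith⁺ (setoid _) (setoid _) eliminant (uppers es) (lowers es)
                                         eliminant-admissible)
    where
    dropHead-admissible : ∀ {u} → u ∈ uppers es → Admissible (tailCone K) (dropHead u)
    dropHead-admissible u∈ =
      let u∈es , up = ∈-filter⁻ upper? u∈ in tail-member K (All.lookup adm u∈es) up
    eliminant-admissible : ∀ {u l} → u ∈ uppers es → l ∈ lowers es →
                           Admissible (tailCone K) (eliminant u l)
    eliminant-admissible {u} {l} u∈ l∈ =
      let u∈es , up  = ∈-filter⁻ upper? u∈
          l∈es , ¬up = ∈-filter⁻ lower? l∈
      in  tail-member K (combine K (α u) (β l) (β-positive {l} ¬up)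
                                 (All.lookup adm u∈es) (All.lookup adm l∈es))
                        (≤-reflexive (cross-balance up (<⇒≤ (≰⇒> ¬up))))

  module Lift (w : Config n) where

    -- X ◂ w ⊨ e unfolds to X * lhs e zero + left e + slack e ≤ X * rhs e zero + right e.

    left right : Constraint (suc n) → ℕ
    left  e = w · tail (lhs e)
    right e = w · tail (rhs e)

    UpperBound LowerBound : Constraint (suc n) → ℕ → Set
    UpperBound u X = X * α u + left u + slack u ≤ right u
    LowerBound l X = left l + slack l ≤ right l + X * β l

    upper-sound : ∀ {u X} → Upper u → UpperBound u X → X ◂ w ⊨ u
    upper-sound {u} {X} up bound =
      subst (λ v → X * v + left u + slack u ≤ X * rhs u zero + right u) (m+[n∸m]≡n up)
            (upper-shift X (rhs u zero) (α u) (left u) (slack u) (right u) bound)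

    lower-sound : ∀ {l X} → ¬ Upper l → LowerBound l X → X ◂ w ⊨ l
    lower-sound {l} {X} ¬up bound =
      subst (λ v → X * lhs l zero + left l + slack l ≤ X * v + right l) (m+[n∸m]≡n (<⇒≤ (≰⇒> ¬up)))
            (lower-shift X (lhs l zero) (β l) (left l) (slack l) (right l) bound)

    upper-from-eliminant : ∀ {u l X} → ¬ Upper l → w ⊨ eliminant u l →
                           X * β l + right l ≤ left l + slack l + β l → UpperBound u X
    upper-from-eliminant {u} {l} {X} ¬up sat tight =
      eliminant-bound (α u) (β l) X (left u) (slack u) (right u) (left l) (slack l) (right l)
        {{>-nonZero (β-positive {l} ¬up)}}
        (subst₂ (λ L R → L + (β l * slack u + α u * slack l + α u * β l) ≤ R)
                (·-linear w (β l) (tail (lhs u)) (α u) (tail (lhs l)))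
                (·-linear w (β l) (tail (rhs u)) (α u) (tail (rhs l))) sat)
        tight

    lower-witness : ∀ {l} us → ¬ Upper l → (∀ {u} → u ∈ us → w ⊨ dropHead u × w ⊨ eliminant u l) →
                    ∃ λ X → LowerBound l X × All (λ u → UpperBound u X) us
    lower-witness {l} us ¬up sat with left l + slack l ≤? right l
    ... | yes fits = 0 , m≤n⇒m≤n+o 0 fits , All.tabulate (proj₁ ∘ sat)
    ... | no  overflow
      with round-up (left l + slack l ∸ right l) (β l) {{>-nonZero (β-positive {l} ¬up)}}
    ...   | X , need≤Xβ , Xβ≤need+β =
      X , lower ,
      All.tabulate (λ {u} u∈ → upper-from-eliminant {u} {l} {X} ¬up (proj₂ (sat u∈)) tight)
      where
      need = left l + slack l ∸ right l
      lower : LowerBound l X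
      lower = ≤-trans (m≤n+m∸n _ (right l)) (+-monoʳ-≤ (right l) need≤Xβ)
      tight : X * β l + right l ≤ left l + slack l + β l
      tight = begin
        X * β l + right l     ≤⟨ +-monoˡ-≤ (right l) Xβ≤need+β ⟩
        need + β l + right l  ≡⟨ +-right-comm need (β l) (right l) ⟩
        need + right l + β l  ≡⟨ cong (_+ β l) (m∸n+n≡m (<⇒≤ (≰⇒> overflow))) ⟩
        left l + slack l + β l ∎

    lift : (es : List (Constraint (suc n))) → All (w ⊨_) (eliminate es) → ∃ λ X → All (X ◂ w ⊨_) es
    lift es sat = X , All.tabulate satisfied
      where
      dropHead-sat : ∀ {u} → u ∈ uppers es → w ⊨ dropHead u
      dropHead-sat u∈ = All.lookup sat (∈-++⁺ˡ (∈-map⁺ dropHead u∈))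
      eliminant-sat : ∀ {u l} → u ∈ uppers es → l ∈ lowers es → w ⊨ eliminant u l
      eliminant-sat u∈ l∈ =
        All.lookup sat (∈-++⁺ʳ (map dropHead (uppers es)) (∈-cartesianProductWith⁺ eliminant u∈ l∈))
      witness : ∃ λ X → All (λ l → LowerBound l X) (lowers es)
                      × All (λ u → UpperBound u X) (uppers es)
      witness = common-witness
        (λ {l} X≤Y bound → ≤-trans bound (+-monoʳ-≤ (right l) (*-monoˡ-≤ (β l) X≤Y)))
        (All.tabulate dropHead-sat)
        (All.tabulate λ {l} l∈ →
          lower-witness {l} (uppers es) (proj₂ (∈-filter⁻ lower? {xs = es} l∈))
                        λ u∈ → dropHead-sat u∈ , eliminant-sat u∈ l∈)
      X = proj₁ witness
      satisfied : ∀ {e} → e ∈ es → X ◂ w ⊨ e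
      satisfied {e} e∈ with upper? e
      ... | yes up =
        upper-sound {e} {X} up (All.lookup (proj₂ (proj₂ witness)) (∈-filter⁺ upper? e∈ up))
      ... | no ¬up =
        lower-sound {e} {X} ¬up (All.lookup (proj₁ (proj₂ witness)) (∈-filter⁺ lower? e∈ ¬up))

open Elimination using (eliminate; eliminate-admissible; module Lift)

farkas : (K : Cone n) (es : List (Constraint n)) → All (Admissible K) es →
         (∃ λ w → All (w ⊨_) es) ⊎ Member K 0ᶜ 0ᶜ
farkas {zero}  K []      _         = inj₁ (0ᶜ , [])
farkas {zero}  K (_ ∷ _) (adm ∷ _) = inj₂ (weaken K adm λ ())
farkas {suc n} K es adm with farkas (tailCone K) (eliminate es) (eliminate-admissible K adm)
... | inj₁ (w , sat) = let X , sat' = Lift.lift w es sat in inj₁ (X ◂ w , sat')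
... | inj₂ trivial   = inj₂ (weaken K trivial λ { zero → z≤n ; (suc _) → z≤n })

-- Linear potentials of execution bounded CRNs

Fireable : CRN k → Reaction k → Set
Fireable C (r , p) = (r , p) ∈ CRN.reactions C × ¬ (r ≗ p)

Potential : CRN k → Config k → Set
Potential C w = ∀ {r p} → Fireable C (r , p) → w · p + size r ≤ w · r

InfiniteExecution : CRN k → Set
InfiniteExecution {k} C = Σ (ℕ → Config k) λ f → ∀ t → Step C (f t) (f (suc t))

module _ {C : CRN k} where

  reactants products : {c d : Config k} → Step C c d → Config k
  reactants s = proj₁ (proj₁ s)
  products  s = proj₂ (proj₁ s)

  step-balance : {c d : Config k} (s : Step C c d) → d ⊕ reactants s ≗ c ⊕ products s
  step-balance {c} {d} ((r , p) , _ , r≤c , d≡ , _) i = begin-equality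
    d i + r i              ≡⟨ cong (_+ r i) (d≡ i) ⟩
    c i ∸ r i + p i + r i  ≡⟨ +-right-comm (c i ∸ r i) (p i) (r i) ⟩
    c i ∸ r i + r i + p i  ≡⟨ cong (_+ p i) (m∸n+n≡m (r≤c i)) ⟩
    c i + p i              ∎

  step-fireable : {c d : Config k} (s : Step C c d) → Fireable C (proj₁ s)
  step-fireable {c} {d} ((r , p) , r∈ , r≤c , d≡ , c≢d) = r∈ , λ r≗p → c≢d λ i → begin-equality
    c i              ≡⟨ m∸n+n≡m (r≤c i) ⟨
    c i ∸ r i + r i  ≡⟨ cong (c i ∸ r i +_) (r≗p i) ⟩
    c i ∸ r i + p i  ≡⟨ d≡ i ⟨
    d i              ∎

  fire : {r p x : Config k} → Fireable C (r , p) → r ≤ᶜ x → Step C x (λ i → x i ∸ r i + p i)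
  fire {r} {p} {x} (r∈ , r≢p) r≤x = (r , p) , r∈ , r≤x , (λ _ → refl) , λ x≗ → r≢p λ i →
    +-cancelˡ-≡ (x i ∸ r i) (r i) (p i) (trans (m∸n+n≡m (r≤x i)) (x≗ i))

  step-shift : {c d : Config k} (e : Config k) → Step C c d → Step C (c ⊕ e) (d ⊕ e)
  step-shift {c} {d} e ((r , p) , r∈ , r≤c , d≡ , c≢d) =
    (r , p) , r∈ , (λ i → ≤-trans (r≤c i) (m≤m+n (c i) (e i))) , shifted ,
    λ c+e≗d+e → c≢d λ i → +-cancelʳ-≡ (e i) (c i) (d i) (c+e≗d+e i)
    where
    shifted : ∀ i → d i + e i ≡ c i + e i ∸ r i + p i
    shifted i = begin-equality
      d i + e i              ≡⟨ cong (_+ e i) (d≡ i) ⟩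
      c i ∸ r i + p i + e i  ≡⟨ +-right-comm (c i ∸ r i) (p i) (e i) ⟩
      c i ∸ r i + e i + p i  ≡⟨ cong (_+ p i) (+-∸-comm (e i) (r≤c i)) ⟨
      c i + e i ∸ r i + p i  ∎

  reach-shift : {c d : Config k} (e : Config k) → Reach C c d → Reach C (c ⊕ e) (d ⊕ e)
  reach-shift e = gmap (_⊕ e) (step-shift e)

total : {A : Set} → (A → Config n) → List A → Config n
total f []       = 0ᶜ
total f (x ∷ xs) = f x ⊕ total f xs

consumed produced : List (Reaction k) → Config k
consumed = total proj₁
produced = total proj₂

copies : {A : Set} → ℕ → List A → List A
copies zero    xs = []
copies (suc m) xs = xs ++ copies m xs

All-copies : {A : Set} {P : A → Set} (m : ℕ) {xs : List A} → All P xs → All P (copies m xs)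
All-copies zero    _  = []
All-copies (suc m) ps = Allₚ.++⁺ ps (All-copies m ps)

total-++ : {A : Set} (f : A → Config n) (xs ys : List A) →
           total f (xs ++ ys) ≗ total f xs ⊕ total f ys
total-++ f []       ys i = refl
total-++ f (x ∷ xs) ys i = trans (cong (f x i +_) (total-++ f xs ys i)) (sym (+-assoc (f x i) _ _))

total-copies : {A : Set} (f : A → Config n) (m : ℕ) (xs : List A) →
               total f (copies m xs) ≗ m ⊛ total f xs
total-copies f zero    xs i = refl
total-copies f (suc m) xs i =
  trans (total-++ f xs (copies m xs) i) (cong (total f xs i +_) (total-copies f m xs i))

total-combination : {A : Set} (f : A → Config n) (β : ℕ) (xs : List A) (α : ℕ) (ys : List A) →
                    total f (copies β xs ++ copies α ys) ≗ β ⊛ total f xs ⊕ α ⊛ total f ys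
total-combination f β xs α ys i =
  trans (total-++ f (copies β xs) (copies α ys) i)
        (cong₂ _+_ (total-copies f β xs i) (total-copies f α ys i))

fire-balance : ∀ {x r} p y c q → r ≤ x → y + c ≡ x ∸ r + p + q → y + (r + c) ≡ x + (p + q)
fire-balance {x} {r} p y c q r≤x balance = begin-equality
  y + (r + c)          ≡⟨ regroup₁ y r c ⟩
  y + c + r            ≡⟨ cong (_+ r) balance ⟩
  x ∸ r + p + q + r    ≡⟨ regroup₂ (x ∸ r) p q r ⟩
  x ∸ r + r + (p + q)  ≡⟨ cong (_+ (p + q)) (m∸n+n≡m r≤x) ⟩
  x + (p + q)          ∎
  where
  regroup₁ : ∀ y r c → y + (r + c) ≡ y + c + r
  regroup₁ = solve-∀
  regroup₂ : ∀ a p q r → a + p + q + r ≡ a + r + (p + q)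
  regroup₂ = solve-∀

fire⁺ : {C : CRN k} (rp : Reaction k) (O : List (Reaction k)) → All (Fireable C) (rp ∷ O) →
        {x : Config k} → consumed (rp ∷ O) ≤ᶜ x →
        ∃ λ y → TransClosure (Step C) x y × (y ⊕ consumed (rp ∷ O) ≗ x ⊕ produced (rp ∷ O))
fire⁺ (r , p) [] (fireable ∷ []) {x} c≤x =
  _ , [ fire fireable r≤x ] , λ i → fire-balance (p i) (x i ∸ r i + p i) 0 0 (r≤x i) refl
  where
  r≤x : r ≤ᶜ x
  r≤x i = ≤-trans (m≤m+n (r i) 0) (c≤x i)
fire⁺ (r , p) (rp ∷ O) (fireable ∷ fireables) {x} c≤x =
  let y , x'⇒y , balance = fire⁺ rp O fireables rest≤x'
  in  y , fire fireable r≤x ∷ x'⇒y ,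
      λ i → fire-balance (p i) (y i) (consumed (rp ∷ O) i) (produced (rp ∷ O) i) (r≤x i) (balance i)
  where
  r≤x : r ≤ᶜ x
  r≤x i = ≤-trans (m≤m+n (r i) _) (c≤x i)
  rest≤x' : consumed (rp ∷ O) ≤ᶜ (λ i → x i ∸ r i + p i)
  rest≤x' i = m≤n⇒m≤n+o (p i) (m+n≤o⇒m≤o∸n (consumed (rp ∷ O) i)
                                 (subst (_≤ x i) (+-comm (r i) _) (c≤x i)))

Certified : CRN k → Config k → Config k → Set
Certified {k} C a a' = Σ[ O ∈ List⁺ (Reaction k) ]
  All (Fireable C) (toList O) × (a ⊕ consumed (toList O) ≤ᶜ a' ⊕ produced (toList O))

pump⇒infinite : (C : CRN k) → Certified C 0ᶜ 0ᶜ → InfiniteExecution C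
pump⇒infinite C (rp ∷ O , fireables , c≤p) = infinite-chain next {consumed (rp ∷ O)} (λ _ → ≤-refl)
  where
  c = consumed (rp ∷ O)
  next : ∀ {x} → c ≤ᶜ x → ∃ λ y → TransClosure (Step C) x y × c ≤ᶜ y
  next {x} c≤x =
    let y , x⇒y , balance = fire⁺ rp O fireables c≤x
    in  y , x⇒y , λ i → +-cancelʳ-≤ (c i) (c i) (y i)
                          (subst (c i + c i ≤_) (sym (balance i)) (+-mono-≤ (c≤x i) (c≤p i)))

transfer-≤ : ∀ a c a' p b b' → a + c ≤ a' + p → b + a' ≤ a + b' → b + c ≤ b' + p
transfer-≤ a c a' p b b' a+c≤a'+p b+a'≤a+b' = +-cancelʳ-≤ a' (b + c) (b' + p) (begin
  b + c + a'   ≡⟨ +-right-comm b c a' ⟩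
  b + a' + c   ≤⟨ +-monoˡ-≤ c b+a'≤a+b' ⟩
  a + b' + c   ≡⟨ +-right-comm a b' c ⟩
  a + c + b'   ≤⟨ +-monoˡ-≤ b' a+c≤a'+p ⟩
  a' + p + b'  ≡⟨ regroup a' p b' ⟩
  b' + p + a'  ∎)
  where
  regroup : ∀ a' p b' → a' + p + b' ≡ b' + p + a'
  regroup = solve-∀

combine-≤ : ∀ α β x y x' y' u v u' v' → x + y ≤ x' + y' → u + v ≤ u' + v' →
            β * x + α * u + (β * y + α * v) ≤ β * x' + α * u' + (β * y' + α * v')
combine-≤ α β x y x' y' u v u' v' x+y≤x'+y' u+v≤u'+v' =
  subst₂ _≤_ (regroup α β x y u v) (regroup α β x' y' u' v')
         (+-mono-≤ (*-monoʳ-≤ β x+y≤x'+y') (*-monoʳ-≤ α u+v≤u'+v'))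
  where
  regroup : ∀ α β x y u v → β * (x + y) + α * (u + v) ≡ β * x + α * u + (β * y + α * v)
  regroup = solve-∀

firingCone : CRN k → Cone k
firingCone {k} C = record
  { Member  = Certified C
  ; weaken  = λ {a a' b b'} → weaken-certified {a} {a'} {b} {b'}
  ; combine = combine-certified
  }
  where
  weaken-certified : ∀ {a a' b b'} → Certified C a a' → (∀ i → b i + a' i ≤ a i + b' i) →
                     Certified C b b'
  weaken-certified {a} {a'} {b} {b'} (O , fireables , bound) b+a'≤a+b' = O , fireables , λ i →
    transfer-≤ (a i) (consumed (toList O) i) (a' i) (produced (toList O) i) (b i) (b' i)
               (bound i) (b+a'≤a+b' i)

  combine-certified : ∀ {a a' b b'} α β → 0 < β → Certified C a a' → Certified C b b' →
                      Certified C (β ⊛ a ⊕ α ⊛ b) (β ⊛ a' ⊕ α ⊛ b')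
  combine-certified α zero ()
  combine-certified {a} {a'} {b} {b'} α β@(suc m) _
                    (rp ∷ O , fireables , bound) (O' , fireables' , bound') =
      rp ∷ (O ++ copies m (rp ∷ O)) ++ copies α (toList O')
    , Allₚ.++⁺ (All-copies β fireables) (All-copies α fireables')
    , λ i → subst₂ _≤_
        (cong (β * a i + α * b i +_) (sym (total-combination proj₁ β (rp ∷ O) α (toList O') i)))
        (cong (β * a' i + α * b' i +_) (sym (total-combination proj₂ β (rp ∷ O) α (toList O') i)))
        (combine-≤ α β (a i) (consumed (rp ∷ O) i) (a' i) (produced (rp ∷ O) i)
                       (b i) (consumed (toList O') i) (b' i) (produced (toList O') i)
                       (bound i) (bound' i))

-- A reaction with r ≗ p never fires, since a step must change the configuration; it is left
-- out because it would certify a spurious pump.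
nontrivial? : (rp : Reaction k) → Dec (¬ (proj₁ rp ≗ proj₂ rp))
nontrivial? (r , p) = ¬? (all? λ i → r i ≟ p i)

reactionConstraint : Reaction k → Constraint k
reactionConstraint (r , p) = record { lhs = p ; rhs = r ; slack = size r }

reactionConstraints : CRN k → List (Constraint k)
reactionConstraints C = map reactionConstraint (filter nontrivial? (CRN.reactions C))

reactionConstraints-admissible : (C : CRN k) →
                                 All (Admissible (firingCone C)) (reactionConstraints C)
reactionConstraints-admissible C = Allₚ.map⁺ (All.tabulate λ {rp} rp∈ →
  rp ∷ [] , ∈-filter⁻ nontrivial? rp∈ ∷ [] , λ i → ≤-reflexive (swap (proj₂ rp i) (proj₁ rp i)))
  where
  swap : ∀ x y → x + (y + 0) ≡ y + (x + 0)
  swap = solve-∀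

bounded⇒potential : (C : CRN k) → ¬ InfiniteExecution C → ∃ (Potential C)
bounded⇒potential C bounded
  with farkas (firingCone C) (reactionConstraints C) (reactionConstraints-admissible C)
... | inj₁ (w , sat) = w , λ (r∈ , nontrivial) →
        All.lookup sat (∈-map⁺ reactionConstraint (∈-filter⁺ nontrivial? r∈ nontrivial))
... | inj₂ pump      = ⊥-elim (bounded (pump⇒infinite C pump))

module _ {C : CRN k} {w : Config k} (potential : Potential C w) where

  step-potential : {c d : Config k} (s : Step C c d) → w · d + size (reactants s) ≤ w · c
  step-potential {c} {d} s = +-cancelʳ-≤ (w · p) (w · d + size r) (w · c) (begin
    w · d + size r + w · p  ≡⟨ +-right-comm (w · d) (size r) (w · p) ⟩
    w · d + w · p + size r  ≡⟨ +-assoc (w · d) (w · p) (size r) ⟩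
    w · d + (w · p + size r) ≤⟨ +-monoʳ-≤ (w · d) (potential (step-fireable s)) ⟩
    w · d + w · r           ≡⟨ ·-⊕ w d r ⟨
    w · (d ⊕ r)             ≡⟨ ·-cong w (step-balance s) ⟩
    w · (c ⊕ p)             ≡⟨ ·-⊕ w c p ⟩
    w · c + w · p           ∎)
    where
    r = reactants s
    p = products s

  -- R collects the reactants consumed along the execution.
  reach-potential : {c d : Config k} → Reach C c d → ∃ λ R → c ≤ᶜ d ⊕ R × w · d + size R ≤ w · c
  reach-potential {c} ε =
    0ᶜ , (λ i → m≤m+n (c i) 0) ,
    ≤-reflexive (trans (cong (w · c +_) (size-0ᶜ {k})) (+-identityʳ (w · c)))
  reach-potential {c} {d} (_◅_ {j = m} s rest) with reach-potential rest
  ... | R , m≤d+R , bound = r ⊕ R , c≤d+r+R , bound'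
    where
    r = reactants s
    c≤d+r+R : c ≤ᶜ d ⊕ (r ⊕ R)
    c≤d+r+R i = begin
      c i                 ≤⟨ m≤m+n (c i) (products s i) ⟩
      c i + products s i  ≡⟨ step-balance s i ⟨
      m i + r i           ≤⟨ +-monoˡ-≤ (r i) (m≤d+R i) ⟩
      d i + R i + r i     ≡⟨ [x+y]+z≡x+[z+y] (d i) (R i) (r i) ⟩
      d i + (r i + R i)   ∎
    bound' : w · d + size (r ⊕ R) ≤ w · c
    bound' = begin
      w · d + size (r ⊕ R)       ≡⟨ cong (w · d +_) (size-⊕ r R) ⟩
      w · d + (size r + size R)  ≡⟨ x+[y+z]≡[x+z]+y (w · d) (size r) (size R) ⟩
      w · d + size R + size r    ≤⟨ +-monoˡ-≤ (size r) bound ⟩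
      w · m + size r             ≤⟨ step-potential s ⟩
      w · c                      ∎

-- Deciders fed one input molecule at a time

supports-disjoint : (D : CRD k σ) → AllVoting D → {y y' : Config k} {b b' : Bool} → b ≢ b' →
                    Output D y b → Output D y' b' → ∀ i → y i ≡ 0 ⊎ y' i ≡ 0
supports-disjoint D allVoting {b = true}  {true}  b≢b' = ⊥-elim (b≢b' refl)
supports-disjoint D allVoting {b = false} {false} b≢b' = ⊥-elim (b≢b' refl)
supports-disjoint D allVoting {b = true}  {false} _ (_ , noAbsent) (_ , yesAbsent') i =
  [ inj₂ ∘ yesAbsent' i , inj₁ ∘ noAbsent i ]′ (allVoting i)
supports-disjoint D allVoting {b = false} {true}  _ (_ , yesAbsent) (_ , noAbsent') i =
  [ inj₁ ∘ yesAbsent i , inj₂ ∘ noAbsent' i ]′ (allVoting i)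

disjoint-≤ᶜ : {y y' e R : Config k} → (∀ i → y i ≡ 0 ⊎ y' i ≡ 0) → y ⊕ e ≤ᶜ y' ⊕ R → y ≤ᶜ R
disjoint-≤ᶜ {y = y} {y'} {e} {R} disjoint y+e≤y'+R i with disjoint i
... | inj₁ y≡0  = subst (_≤ R i) (sym y≡0) z≤n
... | inj₂ y'≡0 = subst (λ v → y i ≤ v + R i) y'≡0 (≤-trans (m≤m+n (y i) (e i)) (y+e≤y'+R i))

occurrences : (ℕ → Fin σ) → ℕ → Fin σ → ℕ
occurrences schedule zero    j = 0
occurrences schedule (suc t) j = occurrences schedule t j + unit (schedule t) j

module Impossibility {k σ} (D : CRD k σ) (ψ : (Fin σ → ℕ) → Bool)
  (noncollapsing : NonCollapsing D) (allVoting : AllVoting D)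
  (bounded : EntirelyExecutionBounded D) (decides : StablyDecides D ψ)
  (schedule : ℕ → Fin σ) where

  open CRD D

  inputs : ℕ → Config k
  inputs zero    = context
  inputs (suc t) = inputs t ⊕ unit (input (schedule t))

  inputs-valid : ∀ t → ValidInit D (inputs t)
  inputs-valid zero    _ _   = refl
  inputs-valid (suc t) i i∉Σ =
    trans (cong (inputs t i +_) (unit-≢ (i∉Σ (schedule t))))
          (trans (+-identityʳ (inputs t i)) (inputs-valid t i i∉Σ))

  inputs-size : ∀ t → t ≤ size (inputs t)
  inputs-size zero    = z≤n
  inputs-size (suc t) = begin
    suc t                            ≡⟨ +-comm 1 t ⟩
    t + 1                            ≤⟨ +-mono-≤ (inputs-size t) (1≤size-unit e) ⟩
    size (inputs t) + size (unit e)  ≡⟨ size-⊕ (inputs t) (unit e) ⟨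
    size (inputs (suc t))            ∎
    where e = input (schedule t)

  inputs-at-input : ∀ t j → inputs t (input j) ≡ occurrences schedule t j
  inputs-at-input zero    j = context-Σ j
  inputs-at-input (suc t) j =
    cong₂ _+_ (inputs-at-input t j) (unit-injective input-inj (schedule t) j)

  private
    w : Config k
    w = proj₁ (bounded⇒potential crn bounded)

    potential : Potential crn w
    potential = proj₂ (bounded⇒potential crn bounded)

  Settled : ℕ × Config k → Set
  Settled (t , y) = Reach crn (inputs t) y × Stable D y × Output D y (ψ (restrict D (inputs t)))

  module _ (alternating : ∀ t → ψ (restrict D (inputs (suc t))) ≢ ψ (restrict D (inputs t))) where

    private
      threshold : ℕ
      threshold = proj₁ (noncollapsing (suc (size w)))

      Late : ℕ × Config k → Set
      Late (t , y) = threshold ≤ t × Settled (t , y)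

      weight : ℕ × Config k → ℕ
      weight (_ , y) = w · y

      large : ∀ {t y} → Late (t , y) → suc (size w) ≤ size y
      large {t} {y} (late , reached , stable , _) =
        proj₂ (noncollapsing (suc (size w))) (size (inputs t)) (≤-trans late (inputs-size t))
              (inputs t) (inputs-valid t) refl y reached stable

      weight-drops : ∀ {y y' R : Config k} j → suc (size w) ≤ size y → y ≤ᶜ R →
                     w · y' + size R ≤ w · (y ⊕ unit j) → w · y' < w · y
      weight-drops {y} {y'} {R} j big y≤R bound =
        +-cancelʳ-≤ (size w) (suc (w · y')) (w · y) (begin
        suc (w · y') + size w  ≡⟨ +-suc (w · y') (size w) ⟨
        w · y' + suc (size w)  ≤⟨ +-monoʳ-≤ (w · y') (≤-trans big (size-mono y≤R)) ⟩
        w · y' + size R        ≤⟨ bound ⟩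
        w · (y ⊕ unit j)       ≡⟨ ·-⊕ w y (unit j) ⟩
        w · y + w · unit j     ≤⟨ +-monoʳ-≤ (w · y) (·-unit≤size w j) ⟩
        w · y + size w         ∎)

      descend : Descent (_<_ on weight) Late
      descend {t , y} late@(t≥threshold , reached , _ , output)
        with decides (inputs (suc t)) (inputs-valid (suc t)) _
                     (reach-shift (unit (input (schedule t))) reached)
      ... | y' , moved , stable' , output' with reach-potential {w = w} potential moved
      ... | R , y+e≤y'+R , bound =
        (suc t , y') ,
        weight-drops (input (schedule t)) (large late)
                     (disjoint-≤ᶜ {y = y} {y'} apart y+e≤y'+R) bound ,
        ≤-trans t≥threshold (n≤1+n t) , reach-shift _ reached ◅◅ moved , stable' , output'
        where
        apart = supports-disjoint D allVoting (alternating t ∘ sym) output output'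

    absurd : ⊥
    absurd =
      let y , settled = decides (inputs threshold) (inputs-valid threshold) (inputs threshold) ε
      in  descent∧wf⇒empty descend (On.wellFounded weight <-wellFounded)
                           (threshold , y) (≤-refl , settled)

-- Parity and majority

occurrences-constant : (j : Fin σ) (t : ℕ) → occurrences (λ _ → j) t j ≡ t
occurrences-constant j zero    = refl
occurrences-constant j (suc t) =
  trans (cong₂ _+_ (occurrences-constant j t) (unit-≡ j)) (+-comm t 1)

parity-alternates : ∀ t → ((suc t % 2) ≡ᵇ 1) ≢ ((t % 2) ≡ᵇ 1)
parity-alternates zero          ()
parity-alternates (suc zero)    ()
parity-alternates (suc (suc t)) = parity-alternates t

parity-impossible : ∀ k (D : CRD k 1) → NonCollapsing D → AllVoting D →
                    EntirelyExecutionBounded D → ¬ StablyDecides D parity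
parity-impossible k D noncollapsing allVoting bounded decides = absurd alternating
  where
  open Impossibility D parity noncollapsing allVoting bounded decides (λ _ → zero)
  parity-at : ∀ t → parity (restrict D (inputs t)) ≡ ((t % 2) ≡ᵇ 1)
  parity-at t =
    cong (λ m → (m % 2) ≡ᵇ 1) (trans (inputs-at-input t zero) (occurrences-constant zero t))
  alternating : ∀ t → parity (restrict D (inputs (suc t))) ≢ parity (restrict D (inputs t))
  alternating t = subst₂ _≢_ (sym (parity-at (suc t))) (sym (parity-at t)) (parity-alternates t)

majoritySchedule : ℕ → Fin 2
majoritySchedule zero          = suc zero
majoritySchedule (suc zero)    = zero
majoritySchedule (suc (suc t)) = majoritySchedule t

majority-occurrences : ∀ t → occurrences majoritySchedule t zero ≡ ⌊ t /2⌋
                           × occurrences majoritySchedule t (suc zero) ≡ ⌈ t /2⌉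
majority-occurrences zero          = refl , refl
majority-occurrences (suc zero)    = refl , refl
majority-occurrences (suc (suc t)) =
  let h₀ , h₁ = majority-occurrences t
  in  trans (two-steps t zero) (cong suc h₀) , trans (two-steps t (suc zero)) (cong suc h₁)
  where
  one-each : ∀ t j → unit (majoritySchedule t) j + unit (majoritySchedule (suc t)) j ≡ 1
  one-each zero          zero          = refl
  one-each zero          (suc zero)    = refl
  one-each (suc zero)    zero          = refl
  one-each (suc zero)    (suc zero)    = refl
  one-each (suc (suc t)) j             = one-each t j
  two-steps : ∀ t j → occurrences majoritySchedule (suc (suc t)) j
                      ≡ suc (occurrences majoritySchedule t j)
  two-steps t j = trans (+-assoc h _ _) (trans (cong (h +_) (one-each t j)) (+-comm h 1))
    where h = occurrences majoritySchedule t j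

≤ᵇ-suc : ∀ m n → (suc m ≤ᵇ suc n) ≡ (m ≤ᵇ n)
≤ᵇ-suc zero    n = refl
≤ᵇ-suc (suc m) n = refl

majority-alternates : ∀ t → (⌈ suc t /2⌉ ≤ᵇ ⌊ suc t /2⌋) ≢ (⌈ t /2⌉ ≤ᵇ ⌊ t /2⌋)
majority-alternates zero          ()
majority-alternates (suc zero)    ()
majority-alternates (suc (suc t)) =
  subst₂ _≢_ (sym (≤ᵇ-suc ⌈ suc t /2⌉ ⌊ suc t /2⌋)) (sym (≤ᵇ-suc ⌈ t /2⌉ ⌊ t /2⌋))
             (majority-alternates t)

majority-impossible : ∀ k (D : CRD k 2) → NonCollapsing D → AllVoting D →
                      EntirelyExecutionBounded D → ¬ StablyDecides D majority
majority-impossible k D noncollapsing allVoting bounded decides = absurd alternating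
  where
  open Impossibility D majority noncollapsing allVoting bounded decides majoritySchedule
  majority-at : ∀ t → majority (restrict D (inputs t)) ≡ (⌈ t /2⌉ ≤ᵇ ⌊ t /2⌋)
  majority-at t = cong₂ _≤ᵇ_ (trans (inputs-at-input t (suc zero)) (proj₂ (majority-occurrences t)))
                             (trans (inputs-at-input t zero) (proj₁ (majority-occurrences t)))
  alternating : ∀ t → majority (restrict D (inputs (suc t))) ≢ majority (restrict D (inputs t))
  alternating t =
    subst₂ _≢_ (sym (majority-at (suc t))) (sym (majority-at t)) (majority-alternates t)

theorem6p7 : (∀ (k : ℕ) (D : CRD k 2) → NonCollapsing D → AllVoting D → EntirelyExecutionBounded D →
    ¬ StablyDecides D majority)
    × (∀ (k : ℕ) (D : CRD k 1) → NonCollapsing D → AllVoting D → EntirelyExecutionBounded D →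
    ¬ StablyDecides D parity)
theorem6p7 = majority-impossible , parity-impossible
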